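{- Let $\mathfrak{k}_1,\dots,\mathfrak{k}_m$ ($m\ge1$) be arrays of positive depth. Then for all $k\geq0$, $$L_{<k}\big(\mathfrak{k}_1\triangleright(\mathfrak{k}_2\triangleright(\cdots\triangleright(\mathfrak{k}_{m-1}\triangleright\mathfrak{k}_m)\cdots))\big)=\sum_{k>i_1>\cdots>i_m\ge0}L_{i_1}(\mathfrak{k}_1)\cdots L_{i_m}(\mathfrak{k}_m).$$
   Context: Let $\mathbb{F}_q$ be a finite field, $K=\mathbb{F}_q(\theta)$, $l_0=1$, $l_i=\prod_{j=1}^i(\theta-\theta^{q^j})$. An array is a tuple $(n_1,\dots,n_r)$ of positive integers ($r\ge1$, the depth), plus the empty array $1$; $\mathfrak{H}(K)$ is the $K$-vector space with basis the arrays, with concatenation extended bilinearly. For $\mathfrak{n}=(n_1,\dots,n_r)$ let $\mathfrak{n}_1=(n_1)$, $\mathfrak{n}_-=(n_2,\dots,n_r)$. Define $L_i(n)=l_i^{ -n}$ ($i\ge0$), $0$ ($i<0$), $L_{<i}(1)=1$, $L_{<i}(\mathfrak{n})=\sum_{j=0}^{i-1}L_j(\mathfrak{n})$, $L_i(\mathfrak{n})=L_i(\mathfrak{n}_1)L_{<i}(\mathfrak{n}_-)$ (depth $\ge2$), extended $K$-linearly. The stuffle product $*$ is bilinear with $1*\mathfrak{m}=\mathfrak{m}*1=\mathfrak{m}$ and $\mathfrak{m}*\mathfrak{n}=\mathfrak{m}_1(\mathfrak{m}_-*\mathfrak{n})+\mathfrak{n}_1(\mathfrak{m}*\mathfrak{n}_-)+(m_1+n_1)(\mathfrak{m}_-*\mathfrak{n}_-)$;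 it satisfies $L_{<i}(\mathfrak{m}*\mathfrak{n})=L_{<i}(\mathfrak{m})L_{<i}(\mathfrak{n})$. The triangle product is $\mathfrak{m}\triangleright\mathfrak{n}=\mathfrak{m}_1(\mathfrak{m}_-*\mathfrak{n})$, extended bilinearly. -}

module Defs where

open import Algebra.Bundles using (CommutativeRing)
open import Data.Nat as ℕ using (ℕ; zero; suc)
open import Data.List using (List; []; _∷_; map; _++_; concatMap; length)
open import Data.List.Relation.Unary.All using (All)
open import Data.Product using (_×_; _,_)

-- An array (n₁,…,n_r) is a list of (positive) naturals; the empty list is the empty array 1.
Array : Set
Array = List ℕ

PosArray : Array → Set
PosArray a = (0 ℕ.< length a) × All (λ n → 1 ℕ.≤ n) a

-- Stuffle product of two basis arrays, as a formal sum (list) of arrays, each with coefficient 1.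
stuffle : Array → Array → List Array
stuffle [] n = n ∷ []
stuffle (a ∷ m) [] = (a ∷ m) ∷ []
stuffle (a ∷ m) (b ∷ n) =
  map (a ∷_) (stuffle m (b ∷ n)) ++
  map (b ∷_) (stuffle (a ∷ m) n) ++
  map ((a ℕ.+ b) ∷_) (stuffle m n)

-- Everything depending on the coefficient ring K, the parameter q, θ, and
-- the inverses linv i = l_i⁻¹.
module Theory {c ℓ} (R : CommutativeRing c ℓ) (q : ℕ)
              (θ : CommutativeRing.Carrier R)
              (linv : ℕ → CommutativeRing.Carrier R) where
  open CommutativeRing R

  pow : Carrier → ℕ → Carrier
  pow x zero = 1#
  pow x (suc n) = pow x n * x

  l : ℕ → Carrier
  l zero = 1#
  l (suc i) = l i * (θ + (- pow θ (q ℕ.^ suc i)))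

  sumR : ℕ → (ℕ → Carrier) → Carrier
  sumR zero f = 0#
  sumR (suc n) f = sumR n f + f n

  -- Elements of 𝔥(K): formal K-linear combinations of arrays.
  H : Set c
  H = List (Carrier × Array)

  -- L_i(𝔫) for arrays of positive depth (the value on the empty array is
  -- never used; it is set to 0), and L_{<i}(𝔫).
  mutual
    Li : ℕ → Array → Carrier
    Li i [] = 0#
    Li i (a ∷ m) = pow (linv i) a * Lless i m

    Lless : ℕ → Array → Carrier
    Lless i [] = 1#
    Lless i (a ∷ m) = sumR i (λ j → Li j (a ∷ m))

  LlessH : ℕ → H → Carrier
  LlessH i [] = 0#
  LlessH i ((x , a) ∷ h) = x * Lless i a + LlessH i h

  stuffleH : H → H → H
  stuffleH x y = concatMap (λ { (u , a) → concatMap (λ { (v , b) →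
                   map (λ w → (u * v , w)) (stuffle a b) }) y }) x

  -- triangle product 𝔪 ▷ 𝔫 = 𝔪₁(𝔪₋ * 𝔫) on basis arrays 𝔪 of positive depth
  -- (𝔪 = 1 never occurs; sent to 0), extended bilinearly
  tri : Array → Array → List Array
  tri [] n = []
  tri (a ∷ m) n = map (a ∷_) (stuffle m n)

  triH : H → H → H
  triH x y = concatMap (λ { (u , a) → concatMap (λ { (v , b) →
                   map (λ w → (u * v , w)) (tri a b) }) y }) x

  -- 𝔨₁ ▷ (𝔨₂ ▷ (⋯ ▷ (𝔨_{m-1} ▷ 𝔨_m)⋯)) for the nonempty list 𝔨₁ ∷ ks
  nest : Array → List Array → H
  nest k₁ [] = (1# , k₁) ∷ []
  nest k₁ (k₂ ∷ ks) = triH ((1# , k₁) ∷ []) (nest k₂ ks)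

  -- Σ_{k > i₁ > ⋯ > i_m ≥ 0} L_{i₁}(𝔨₁)⋯L_{i_m}(𝔨_m), written as iterated sums
  rhs : ℕ → Array → List Array → Carrier
  rhs k k₁ [] = sumR k (λ i → Li i k₁)
  rhs k k₁ (k₂ ∷ ks) = sumR k (λ i → Li i k₁ * rhs i k₂ ks)

module Submission where

-- Unfolding L_{<j}(𝔫) = Σ_{i<j} L_i(𝔫) once at its top index turns
-- L_{<k}(𝔨₁ ▷ 𝔥) into Σ_{j<k} L_j(𝔨₁) L_{<j}(𝔥), provided L_{<j} is
-- multiplicative for the stuffle product; that in turn is the familiar
-- induction on k, where the three terms of 𝔪 * 𝔫 match the three terms of
-- (L_{<k}(𝔪) + L_k(𝔪)) (L_{<k}(𝔫) + L_k(𝔫)).  Iterating along the nest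
-- produces the iterated sum over k > i₁ > ⋯ > i_m ≥ 0.

open import Defs
open import Level using (Level)
open import Algebra.Bundles using (CommutativeRing)
open import Data.Nat as ℕ using (ℕ; zero; suc)
open import Data.List using (List; []; _∷_; map; _++_; length)
open import Data.List.Properties using (++-assoc)
open import Data.List.Relation.Unary.All as All using (All; _∷_)
open import Data.Product using (_,_; proj₁)
open import Data.Maybe using (nothing)
import Relation.Binary.PropositionalEquality as ≡
import Relation.Binary.Reasoning.Setoid as SetoidReasoning
open import Tactic.RingSolver using (solve-∀)
open import Tactic.RingSolver.Core.AlmostCommutativeRing using (AlmostCommutativeRing; fromCommutativeRing)

module RingIdentities {c ℓ} (R : CommutativeRing c ℓ) where
  ACR : AlmostCommutativeRing c ℓ
  ACR = fromCommutativeRing R (λ _ → nothing)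
  open AlmostCommutativeRing ACR

  +-interchange : ∀ a b c d → (a + b) + (c + d) ≈ (a + c) + (b + d)
  +-interchange = solve-∀ ACR

  +-regroup : ∀ a b c u v w → (a + u) + ((b + v) + (c + w)) ≈ (a + (b + c)) + (u + (v + w))
  +-regroup = solve-∀ ACR

  binomial-expansion : ∀ a b p q s t →
    (a + p * s) * (b + q * t) ≈ a * b + (p * (s * b) + (q * (a * t) + (p * q) * (s * t)))
  binomial-expansion = solve-∀ ACR

module Harmonic {c ℓ} (R : CommutativeRing c ℓ) (q : ℕ)
    (θ : CommutativeRing.Carrier R) (linv : ℕ → CommutativeRing.Carrier R) where
  open CommutativeRing R
  open Theory R q θ linv
  open RingIdentities R using (+-interchange; +-regroup; binomial-expansion)
  open SetoidReasoning setoid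

  sumR-cong : ∀ k {f g : ℕ → Carrier} → (∀ j → f j ≈ g j) → sumR k f ≈ sumR k g
  sumR-cong zero    f≈g = refl
  sumR-cong (suc k) f≈g = +-cong (sumR-cong k f≈g) (f≈g k)

  sumR-zero : ∀ k {f : ℕ → Carrier} → (∀ j → f j ≈ 0#) → sumR k f ≈ 0#
  sumR-zero zero    f≈0 = refl
  sumR-zero (suc k) f≈0 = trans (+-cong (sumR-zero k f≈0) (f≈0 k)) (+-identityˡ 0#)

  sumR-+ : ∀ k (f g : ℕ → Carrier) → sumR k (λ j → f j + g j) ≈ sumR k f + sumR k g
  sumR-+ zero    f g = sym (+-identityˡ 0#)
  sumR-+ (suc k) f g = begin
    sumR k (λ j → f j + g j) + (f k + g k) ≈⟨ +-cong (sumR-+ k f g) refl ⟩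
    (sumR k f + sumR k g) + (f k + g k)    ≈⟨ +-interchange _ _ _ _ ⟩
    (sumR k f + f k) + (sumR k g + g k)    ∎

  *-sumR : ∀ k x (f : ℕ → Carrier) → x * sumR k f ≈ sumR k (λ j → x * f j)
  *-sumR zero    x f = zeroʳ x
  *-sumR (suc k) x f = trans (distribˡ x _ _) (+-cong (*-sumR k x f) refl)

  *-rearrange : ∀ v p s t → v * (p * (s * t)) ≈ (p * s) * (v * t)
  *-rearrange v p s t = begin
    v * (p * (s * t)) ≈⟨ *-cong refl (*-assoc p s t) ⟨
    v * ((p * s) * t) ≈⟨ *-assoc v (p * s) t ⟨
    (v * (p * s)) * t ≈⟨ *-cong (*-comm v (p * s)) refl ⟩
    ((p * s) * v) * t ≈⟨ *-assoc (p * s) v t ⟩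
    (p * s) * (v * t) ∎

  pow-+ : ∀ x a b → pow x (a ℕ.+ b) ≈ pow x a * pow x b
  pow-+ x zero    b = sym (*-identityˡ _)
  pow-+ x (suc a) b = begin
    pow x (a ℕ.+ b) * x       ≈⟨ *-cong (pow-+ x a b) refl ⟩
    (pow x a * pow x b) * x   ≈⟨ *-assoc _ _ _ ⟩
    pow x a * (pow x b * x)   ≈⟨ *-cong refl (*-comm _ _) ⟩
    pow x a * (x * pow x b)   ≈⟨ *-assoc _ _ _ ⟨
    (pow x a * x) * pow x b   ∎

  LlessΣ : ℕ → List Array → Carrier
  LlessΣ k []       = 0#
  LlessΣ k (w ∷ ws) = Lless k w + LlessΣ k ws

  LlessΣ-++ : ∀ k us ws → LlessΣ k (us ++ ws) ≈ LlessΣ k us + LlessΣ k ws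
  LlessΣ-++ k []       ws = sym (+-identityˡ _)
  LlessΣ-++ k (u ∷ us) ws = trans (+-cong refl (LlessΣ-++ k us ws)) (sym (+-assoc _ _ _))

  LlessΣ-map-∷ : ∀ k a ws →
    LlessΣ k (map (a ∷_) ws) ≈ sumR k (λ j → pow (linv j) a * LlessΣ j ws)
  LlessΣ-map-∷ k a []       = sym (sumR-zero k (λ j → zeroʳ _))
  LlessΣ-map-∷ k a (w ∷ ws) = begin
    Lless k (a ∷ w) + LlessΣ k (map (a ∷_) ws)
      ≈⟨ +-cong refl (LlessΣ-map-∷ k a ws) ⟩
    sumR k (λ j → pow (linv j) a * Lless j w) + sumR k (λ j → pow (linv j) a * LlessΣ j ws)
      ≈⟨ sumR-+ k _ _ ⟨
    sumR k (λ j → pow (linv j) a * Lless j w + pow (linv j) a * LlessΣ j ws)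
      ≈⟨ sumR-cong k (λ j → distribˡ _ _ _) ⟨
    sumR k (λ j → pow (linv j) a * (Lless j w + LlessΣ j ws)) ∎

  Lless-∷-*-Lless-∷ : ∀ a b m n k →
    sumR k (λ j → pow (linv j) a * (Lless j m * Lless j (b ∷ n))) +
    (sumR k (λ j → pow (linv j) b * (Lless j (a ∷ m) * Lless j n)) +
     sumR k (λ j → pow (linv j) (a ℕ.+ b) * (Lless j m * Lless j n)))
    ≈ Lless k (a ∷ m) * Lless k (b ∷ n)
  Lless-∷-*-Lless-∷ a b m n zero =
    trans (+-identityˡ _) (trans (+-identityˡ _) (sym (zeroʳ 0#)))
  Lless-∷-*-Lless-∷ a b m n (suc k) = begin
    (A + xᵃ * (Lm * LB)) + ((B + xᵇ * (LA * Ln)) + (C + pow x (a ℕ.+ b) * (Lm * Ln)))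
      ≈⟨ +-regroup _ _ _ _ _ _ ⟩
    (A + (B + C)) + (xᵃ * (Lm * LB) + (xᵇ * (LA * Ln) + pow x (a ℕ.+ b) * (Lm * Ln)))
      ≈⟨ +-cong (Lless-∷-*-Lless-∷ a b m n k)
                (+-cong refl (+-cong refl (*-cong (pow-+ x a b) refl))) ⟩
    LA * LB + (xᵃ * (Lm * LB) + (xᵇ * (LA * Ln) + (xᵃ * xᵇ) * (Lm * Ln)))
      ≈⟨ binomial-expansion _ _ _ _ _ _ ⟨
    (LA + xᵃ * Lm) * (LB + xᵇ * Ln) ∎
    where
    x = linv k
    xᵃ = pow x a
    xᵇ = pow x b
    Lm = Lless k m
    Ln = Lless k n
    LA = Lless k (a ∷ m)
    LB = Lless k (b ∷ n)
    A = sumR k (λ j → pow (linv j) a * (Lless j m * Lless j (b ∷ n)))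
    B = sumR k (λ j → pow (linv j) b * (Lless j (a ∷ m) * Lless j n))
    C = sumR k (λ j → pow (linv j) (a ℕ.+ b) * (Lless j m * Lless j n))

  Lless-stuffle : ∀ m n k → LlessΣ k (stuffle m n) ≈ Lless k m * Lless k n
  Lless-stuffle []      n       k = trans (+-identityʳ _) (sym (*-identityˡ _))
  Lless-stuffle (a ∷ m) []      k = trans (+-identityʳ _) (sym (*-identityʳ _))
  Lless-stuffle (a ∷ m) (b ∷ n) k = begin
    LlessΣ k (map (a ∷_) (stuffle m (b ∷ n)) ++
              map (b ∷_) (stuffle (a ∷ m) n) ++ map ((a ℕ.+ b) ∷_) (stuffle m n))
      ≈⟨ trans (LlessΣ-++ k (map (a ∷_) (stuffle m (b ∷ n))) _)
              (+-cong refl (LlessΣ-++ k (map (b ∷_) (stuffle (a ∷ m) n)) _)) ⟩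
    LlessΣ k (map (a ∷_) (stuffle m (b ∷ n))) +
      (LlessΣ k (map (b ∷_) (stuffle (a ∷ m) n)) + LlessΣ k (map ((a ℕ.+ b) ∷_) (stuffle m n)))
      ≈⟨ +-cong (LlessΣ-map-∷ k a (stuffle m (b ∷ n)))
           (+-cong (LlessΣ-map-∷ k b (stuffle (a ∷ m) n)) (LlessΣ-map-∷ k (a ℕ.+ b) (stuffle m n))) ⟩
    sumR k (λ j → pow (linv j) a * LlessΣ j (stuffle m (b ∷ n))) +
      (sumR k (λ j → pow (linv j) b * LlessΣ j (stuffle (a ∷ m) n)) +
       sumR k (λ j → pow (linv j) (a ℕ.+ b) * LlessΣ j (stuffle m n)))
      ≈⟨ +-cong (sumR-cong k (λ j → *-cong refl (Lless-stuffle m (b ∷ n) j)))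
           (+-cong (sumR-cong k (λ j → *-cong refl (Lless-stuffle (a ∷ m) n j)))
                   (sumR-cong k (λ j → *-cong refl (Lless-stuffle m n j)))) ⟩
    sumR k (λ j → pow (linv j) a * (Lless j m * Lless j (b ∷ n))) +
      (sumR k (λ j → pow (linv j) b * (Lless j (a ∷ m) * Lless j n)) +
       sumR k (λ j → pow (linv j) (a ℕ.+ b) * (Lless j m * Lless j n)))
      ≈⟨ Lless-∷-*-Lless-∷ a b m n k ⟩
    Lless k (a ∷ m) * Lless k (b ∷ n) ∎

  LlessH-++ : ∀ k (g h : H) → LlessH k (g ++ h) ≈ LlessH k g + LlessH k h
  LlessH-++ k []      h = sym (+-identityˡ _)
  LlessH-++ k (x ∷ g) h = trans (+-cong refl (LlessH-++ k g h)) (sym (+-assoc _ _ _))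

  LlessH-scale : ∀ k u ws → LlessH k (map (λ w → (u , w)) ws) ≈ u * LlessΣ k ws
  LlessH-scale k u []       = sym (zeroʳ u)
  LlessH-scale k u (w ∷ ws) = trans (+-cong refl (LlessH-scale k u ws)) (sym (distribˡ _ _ _))

  LlessH-triH : ∀ a m h k →
    LlessH k (triH ((1# , a ∷ m) ∷ []) h) ≈ sumR k (λ j → Li j (a ∷ m) * LlessH j h)
  LlessH-triH a m []             k = sym (sumR-zero k (λ j → zeroʳ _))
  LlessH-triH a m ((v , b) ∷ h) k = begin
    LlessH k (triH ((1# , a ∷ m) ∷ []) ((v , b) ∷ h))
      ≈⟨ reflexive (≡.cong (LlessH k) (++-assoc head _ [])) ⟩
    LlessH k (head ++ triH ((1# , a ∷ m) ∷ []) h)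
      ≈⟨ LlessH-++ k head _ ⟩
    LlessH k head + LlessH k (triH ((1# , a ∷ m) ∷ []) h)
      ≈⟨ +-cong (LlessH-scale k (1# * v) (map (a ∷_) (stuffle m b))) (LlessH-triH a m h k) ⟩
    (1# * v) * LlessΣ k (map (a ∷_) (stuffle m b)) + sumR k (λ j → Li j (a ∷ m) * LlessH j h)
      ≈⟨ +-cong (trans (*-cong (*-identityˡ v) (LlessΣ-map-∷ k a (stuffle m b))) (*-sumR k v _)) refl ⟩
    sumR k (λ j → v * (pow (linv j) a * LlessΣ j (stuffle m b))) + sumR k (λ j → Li j (a ∷ m) * LlessH j h)
      ≈⟨ +-cong (sumR-cong k (λ j → *-cong refl (*-cong refl (Lless-stuffle m b j)))) refl ⟩
    sumR k (λ j → v * (pow (linv j) a * (Lless j m * Lless j b))) + sumR k (λ j → Li j (a ∷ m) * LlessH j h)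
      ≈⟨ +-cong (sumR-cong k (λ j → *-rearrange v (pow (linv j) a) (Lless j m) (Lless j b))) refl ⟩
    sumR k (λ j → Li j (a ∷ m) * (v * Lless j b)) + sumR k (λ j → Li j (a ∷ m) * LlessH j h)
      ≈⟨ sumR-+ k _ _ ⟨
    sumR k (λ j → Li j (a ∷ m) * (v * Lless j b) + Li j (a ∷ m) * LlessH j h)
      ≈⟨ sumR-cong k (λ j → distribˡ _ _ _) ⟨
    sumR k (λ j → Li j (a ∷ m) * (v * Lless j b + LlessH j h)) ∎
    where
    head = map (λ w → (1# * v , w)) (map (a ∷_) (stuffle m b))

  LlessH-nest : (k₁ : Array) (ks : List Array) → All (λ a → 0 ℕ.< length a) (k₁ ∷ ks)
    → (k : ℕ) → LlessH k (nest k₁ ks) ≈ rhs k k₁ ks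
  LlessH-nest []      ks        (() ∷ _)  k
  LlessH-nest (a ∷ m) []        _         k = trans (+-identityʳ _) (*-identityˡ _)
  LlessH-nest (a ∷ m) (k₂ ∷ ks) (_ ∷ pos) k =
    trans (LlessH-triH a m (nest k₂ ks) k)
          (sumR-cong k (λ j → *-cong refl (LlessH-nest k₂ ks pos j)))

-- The identity is formal in the values linv i, so the hypothesis l_i · linv i = 1
-- is not needed; of PosArray only nonemptiness is used.
mainTheorem10 : ∀ {c ℓ : Level} (R : CommutativeRing c ℓ) (q : ℕ)
    (θ : CommutativeRing.Carrier R) (linv : ℕ → CommutativeRing.Carrier R)
    → (∀ i → CommutativeRing._≈_ R (CommutativeRing._*_ R (Theory.l R q θ linv i) (linv i)) (CommutativeRing.1# R))
    → (k₁ : Array) (ks : List Array) → All PosArray (k₁ ∷ ks)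
    → (k : ℕ)
    → CommutativeRing._≈_ R (Theory.LlessH R q θ linv k (Theory.nest R q θ linv k₁ ks))
    (Theory.rhs R q θ linv k k₁ ks)
mainTheorem10 R q θ linv _ k₁ ks pos =
  Harmonic.LlessH-nest R q θ linv k₁ ks (All.map proj₁ pos)
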